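{- Let $n\ge 3$ and let $S=\{(1\,2),(2\,3),(3\,4),\dots,(n-1\ n)\}\subseteq S_n$. Then the $G$-graph $\Gamma(S_n,S)$ is $(n-1)$-partite (its vertex set is partitioned into the $n-1$ classes $V_s$, $s\in S$, each containing no edge), $(2n-4)$-regular, and has $\frac{n(n-1)(n-1)!}{2}$ vertices.
   Context: For a group $G$ generated by a finite set $S$, the $G$-graph $\Gamma(G,S)$ has vertex set the disjoint union over $s\in S$ of the sets $V_s$ of right cosets $\langle s\rangle x$ ($x\in G$) of the cyclic subgroup $\langle s\rangle$; for $s\neq t$ in $S$, $\langle s\rangle x$ and $\langle t\rangle y$ are joined by exactly $|\langle s\rangle x\cap\langle t\rangle y|$ parallel edges; vertices in the same $V_s$ are non-adjacent and there are no loops. Degrees count edges with multiplicity. -}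

module Defs where

open import Level using (0ℓ)
open import Data.Nat.Base using (ℕ; zero; suc)
open import Data.Fin.Base using (Fin; inject₁)
import Data.Fin.Base as F
open import Data.Fin.Permutation using (Permutation′; _⟨$⟩ʳ_; _∘ₚ_; transpose; _≈_)
import Data.Fin.Permutation as P
open import Data.Product.Base using (Σ; _×_; _,_; ∃-syntax; proj₁; proj₂)
open import Function.Bundles using (_⇔_; Inverse)
import Function.Properties.Equivalence as ⇔
open import Relation.Binary.Bundles using (Setoid)
open import Relation.Binary.PropositionalEquality as ≡ using (_≡_; _≢_)
open import Relation.Nullary using (¬_)

-- The symmetric group S_n: permutations of Fin n, with equality the
-- pointwise equality _≈_ of Data.Fin.Permutation.

Perm : ℕ → Set
Perm n = Permutation′ n

-- Group product, written as composition of functions: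
-- (g · h) ⟨$⟩ʳ i = g ⟨$⟩ʳ (h ⟨$⟩ʳ i).
infixl 7 _·_
_·_ : ∀ {n} → Perm n → Perm n → Perm n
g · h = h ∘ₚ g

pow : ∀ {n} → Perm n → ℕ → Perm n
pow s zero    = P.id
pow s (suc k) = s · pow s k

InCoset : ∀ {n} → Perm n → Perm n → Perm n → Set
InCoset s x g = ∃[ k ] (g ≈ pow s k · x)

HasCard : Setoid 0ℓ 0ℓ → ℕ → Set
HasCard A k = Inverse A (≡.setoid (Fin k))

-- The G-graph Γ(G,S) for G = S_n and S given as a family
-- S : Fin m → Perm n  (the s ∈ S are indexed by Fin m).

module GGraph {n m : ℕ} (S : Fin m → Perm n) where

  -- A vertex ⟨S i⟩x of V_{S i}, given by the index i and a
  -- representative x of the coset.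
  Vertex : Set
  Vertex = Σ (Fin m) (λ _ → Perm n)

  class : Vertex → Fin m
  class = proj₁

  _∈V_ : Perm n → Vertex → Set
  g ∈V (i , x) = InCoset (S i) x g

  _≈V_ : Vertex → Vertex → Set
  v ≈V w = (class v ≡ class w) × (∀ g → (g ∈V v) ⇔ (g ∈V w))

  VertexSetoid : Setoid 0ℓ 0ℓ
  VertexSetoid = record
    { Carrier = Vertex
    ; _≈_ = _≈V_
    ; isEquivalence = record
      { refl  = ≡.refl , λ g → ⇔.refl
      ; sym   = λ (p , q) → ≡.sym p , λ g → ⇔.sym (q g)
      ; trans = λ (p , q) (p′ , q′) → ≡.trans p p′ , λ g → ⇔.trans (q g) (q′ g)
      }
    }

  -- The edges joining v and w are indexed by the elements g of the
  -- intersection v ∩ w, and exist only when v, w lie in different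
  -- classes V_s, V_t (s ≠ t).  Hence v and w are joined by exactly
  -- |v ∩ w| parallel edges (0 if class v ≡ class w; no loops).
  EdgeAt : Vertex → Vertex → Perm n → Set
  EdgeAt v w g = (class v ≢ class w) × (g ∈V v) × (g ∈V w)

  -- Its cardinality is
  -- Σ_w |{edges between v and w}|, i.e. the degree of v.
  IncidentSetoid : Vertex → Setoid 0ℓ 0ℓ
  IncidentSetoid v = record
    { Carrier = Σ (Vertex × Perm n) (λ (w , g) → EdgeAt v w g)
    ; _≈_ = λ ((w , g) , _) ((w′ , g′) , _) → (w ≈V w′) × (g ≈ g′)
    ; isEquivalence = record
      { refl  = λ {((w , _) , _)} → Setoid.refl VertexSetoid {w} , λ i → ≡.refl
      ; sym   = λ {((w , _) , _)} {((w′ , _) , _)} (p , q) →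
                  Setoid.sym VertexSetoid {w} {w′} p , λ i → ≡.sym (q i)
      ; trans = λ {((w , _) , _)} {((w′ , _) , _)} {((w″ , _) , _)} (p , q) (p′ , q′) →
                  Setoid.trans VertexSetoid {w} {w′} {w″} p p′ , λ i → ≡.trans (q i) (q′ i)
      }
    }

  HasDegree : Vertex → ℕ → Set
  HasDegree v d = HasCard (IncidentSetoid v) d

  Regular : ℕ → Set
  Regular d = ∀ v → HasDegree v d

  HasVertices : ℕ → Set
  HasVertices N = HasCard VertexSetoid N

  -- m-partite with parts V_{S i}, i : Fin m: the S i are pairwise
  -- distinct (so there are exactly m classes), and no edge joins two
  -- vertices of the same class.
  PartiteByClasses : Set
  PartiteByClasses =
    (∀ i j → S i ≈ S j → i ≡ j) ×
    (∀ v w → class v ≡ class w → ∀ g → ¬ EdgeAt v w g)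

-- The adjacent transpositions (i+1  i+2) in S_{m+1}, i : Fin m
-- (in 1-based notation: (1 2), (2 3), …, (m  m+1)).

adjTransp : (m : ℕ) → Fin m → Perm (suc m)
adjTransp m i = transpose (inject₁ i) (F.suc i)

module Submission where

-- Every s ∈ S is a transposition, so ⟨s⟩x = {x , s x}: the cosets in V_s are the orbits of
-- the fixed-point-free involution x ↦ s x of S_n, and pairing off these orbits gives
-- |V_s| = n!/2, hence (n-1)·n!/2 vertices.  An edge at ⟨s⟩x is a choice of g ∈ {x , s x}
-- and of a class t ≠ s, the other endpoint being ⟨t⟩g; so every vertex has degree
-- 2(n-2).  The classes V_s carry no edges by construction, and distinct adjacent
-- transpositions are distinct permutations.

open import Defs
open import Data.Nat using (ℕ; zero; suc; _+_; _*_; _∸_; _≤_; _/_; _!; s≤s; z≤n)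
open import Data.Nat.Properties using (*-suc; *-comm; *-assoc; m≢1+n+m)
open import Data.Nat.DivMod using (m*n/n≡m; *-/-assoc)
open import Data.Nat.Divisibility using (m≤n⇒m!∣n!)
open import Data.Fin using (Fin; zero; suc; inject₁; toℕ; _≟_; punchIn; punchOut; combine; remQuot)
open import Data.Fin.Properties
  using ( ¬Fin0; suc-injective; inject₁-injective; toℕ-inject₁; punchOut-cong; punchOut-injective
        ; punchOut-punchIn; punchIn-injective; punchInᵢ≢i; combine-injective; combine-remQuot )
open import Data.Fin.Permutation using (_⟨$⟩ʳ_; _⟨$⟩ˡ_; _≈_; transpose)
import Data.Fin.Permutation as P
import Data.Fin.Permutation.Components as PC
open import Data.Product using (Σ; ∃-syntax; _×_; _,_; proj₁; proj₂)
open import Data.Sum using (_⊎_; inj₁; inj₂)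
open import Data.Empty using (⊥-elim)
open import Function.Base using (_on_)
open import Function.Bundles using (_⇔_; mk⇔; Equivalence)
open import Level using (0ℓ)
open import Relation.Binary.Core using (Rel)
open import Relation.Binary.Definitions using (Decidable; Reflexive)
open import Relation.Binary.Structures using (IsEquivalence)
open import Relation.Binary.Bundles using (Setoid)
open import Relation.Binary.PropositionalEquality
  using (_≡_; _≢_; refl; sym; trans; cong; cong₂; subst; module ≡-Reasoning)
open import Relation.Nullary using (¬_; Dec; yes; no)
open import Relation.Nullary.Decidable using (map′; _⊎-dec_; dec-true; dec-false)

-- HasCard without packaging ∼ into a setoid.
record Enumeration {A : Set} (_∼_ : Rel A 0ℓ) (k : ℕ) : Set where
  field
    to           : A → Fin k
    to-cong      : ∀ {x y} → x ∼ y → to x ≡ to y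
    to-injective : ∀ {x y} → to x ≡ to y → x ∼ y
    from         : Fin k → A
    to∘from      : ∀ i → to (from i) ≡ i

  decidable : Decidable _∼_
  decidable x y = map′ to-injective to-cong (to x ≟ to y)

open Enumeration

Enumeration⇒HasCard : ∀ (A : Setoid 0ℓ 0ℓ) {k} → Enumeration (Setoid._≈_ A) k → HasCard A k
Enumeration⇒HasCard A e = record
  { to        = to e
  ; from      = from e
  ; to-cong   = to-cong e
  ; from-cong = λ { refl → Setoid.refl A }
  ; inverse   = (λ {i} p → trans (to-cong e p) (to∘from e i))
              , (λ {_} {i} p → to-injective e (trans (to∘from e i) p))
  }

module _ {A B : Set} {_∼_ : Rel A 0ℓ} {_≈_ : Rel B 0ℓ} {k : ℕ} where

  reindex : (f : B → A) (g : A → B) →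
            (∀ {x y} → x ≈ y → f x ∼ f y) → (∀ {x y} → f x ∼ f y → x ≈ y) →
            (∀ a → f (g a) ∼ a) → Enumeration _∼_ k → Enumeration _≈_ k
  reindex f g f-cong f-reflects f∘g e = record
    { to           = λ x → to e (f x)
    ; to-cong      = λ p → to-cong e (f-cong p)
    ; to-injective = λ p → f-reflects (to-injective e p)
    ; from         = λ i → g (from e i)
    ; to∘from      = λ i → trans (to-cong e (f∘g (from e i))) (to∘from e i)
    }

module _ {A : Set} {_∼_ : Rel A 0ℓ} where

  without : ∀ {k} → Enumeration _∼_ (suc k) → (a : A) →
            Enumeration {Σ A (λ x → ¬ x ∼ a)} (_∼_ on proj₁) k
  without e a = record
    { to           = λ (x , x≁a) → punchOut (to≢ x≁a)
    ; to-cong      = λ p → punchOut-cong (to e a) (to-cong e p)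
    ; to-injective = λ {(_ , x≁a)} {(_ , y≁a)} p →
                       to-injective e (punchOut-injective (to≢ x≁a) (to≢ y≁a) p)
    ; from         = λ i → from e (punchIn (to e a) i) , from-punchIn≁a i
    ; to∘from      = λ i → trans (punchOut-cong (to e a) (to∘from e _)) (punchOut-punchIn (to e a))
    }
    where
    to≢ : ∀ {x} → ¬ x ∼ a → to e a ≢ to e x
    to≢ x≁a p = x≁a (to-injective e (sym p))
    from-punchIn≁a : ∀ i → ¬ from e (punchIn (to e a) i) ∼ a
    from-punchIn≁a i p = punchInᵢ≢i (to e a) i (trans (sym (to∘from e _)) (to-cong e p))

withoutBoth : ∀ {A : Set} {_∼_ : Rel A 0ℓ} {k} → Reflexive _∼_ → Enumeration _∼_ (suc (suc k)) →
              (a b : A) → ¬ b ∼ a → Enumeration {Σ A (λ x → ¬ (x ∼ a ⊎ x ∼ b))} (_∼_ on proj₁) k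
withoutBoth {A} {_∼_} ∼-refl e a b b≁a =
  reindex nest flatten (λ p → p) (λ p → p) (λ _ → ∼-refl) (without (without e a) (b , b≁a))
    where
    nest : Σ A (λ x → ¬ (x ∼ a ⊎ x ∼ b)) → Σ (Σ A (λ x → ¬ x ∼ a)) (λ u → ¬ proj₁ u ∼ b)
    nest (x , x∉) = (x , λ p → x∉ (inj₁ p)) , λ p → x∉ (inj₂ p)
    flatten : Σ (Σ A (λ x → ¬ x ∼ a)) (λ u → ¬ proj₁ u ∼ b) → Σ A (λ x → ¬ (x ∼ a ⊎ x ∼ b))
    flatten ((x , x≁a) , x≁b) = x , λ { (inj₁ p) → x≁a p ; (inj₂ p) → x≁b p }

Fibrewise : ∀ {m} {A : Set} → (Fin m → Rel A 0ℓ) → Rel (Fin m × A) 0ℓ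
Fibrewise R (i , x) (j , y) = i ≡ j × R i x y

×-enumeration : ∀ {m k} {A : Set} {R : Fin m → Rel A 0ℓ} →
                (∀ i → Enumeration (R i) k) → Enumeration (Fibrewise R) (m * k)
×-enumeration {m} {k} {R = R} e = record
  { to           = λ (i , x) → combine i (to (e i) x)
  ; to-cong      = λ { {i , _} (refl , p) → cong (combine i) (to-cong (e i) p) }
  ; to-injective = injective
  ; from         = λ c → let (i , j) = remQuot {m} k c in i , from (e i) j
  ; to∘from      = λ c → let (i , j) = remQuot {m} k c in
                     trans (cong (combine i) (to∘from (e i) j)) (combine-remQuot {m} k c)
  }
  where
  injective : ∀ {u v} → combine (proj₁ u) (to (e (proj₁ u)) (proj₂ u)) ≡ combine (proj₁ v) (to (e (proj₁ v)) (proj₂ v)) →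
              Fibrewise R u v
  injective {i , _} {j , _} p with combine-injective i _ j _ p
  ... | refl , q = refl , to-injective (e i) q

adjoinClass : ∀ {A : Set} {R : Rel A 0ℓ} {k} → IsEquivalence R → Decidable R → (a : A) →
              Enumeration {Σ A (λ x → ¬ R a x)} (R on proj₁) k → Enumeration R (suc k)
adjoinClass {A} {R} {k} isEq R? a e = record
  { to           = λ x → index x (R? a x)
  ; to-cong      = λ p → index-cong p _ _
  ; to-injective = index-injective _ _
  ; from         = λ { zero → a ; (suc i) → proj₁ (from e i) }
  ; to∘from      = λ { zero    → index-class R-refl (R? a a)
                     ; (suc i) → trans (index-rest (proj₂ (from e i)) _) (cong suc (to∘from e i)) }
  }
  where
  open IsEquivalence isEq renaming (refl to R-refl; sym to R-sym; trans to R-trans)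
  index : ∀ x → Dec (R a x) → Fin (suc k)
  index x (yes _) = zero
  index x (no a≁x) = suc (to e (x , a≁x))

  index-class : ∀ {x} → R a x → (d : Dec (R a x)) → index x d ≡ zero
  index-class _ (yes _) = refl
  index-class p (no a≁x) = ⊥-elim (a≁x p)

  index-rest : ∀ {x} (a≁x : ¬ R a x) (d : Dec (R a x)) → index x d ≡ suc (to e (x , a≁x))
  index-rest a≁x (yes p) = ⊥-elim (a≁x p)
  index-rest a≁x (no _) = cong suc (to-cong e R-refl)

  index-cong : ∀ {x y} → R x y → (d : Dec (R a x)) (d′ : Dec (R a y)) → index x d ≡ index y d′
  index-cong p (yes q) d′ = sym (index-class (R-trans q p) d′)
  index-cong p (no a≁x) (yes q) = ⊥-elim (a≁x (R-trans q (R-sym p)))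
  index-cong p (no _) (no _) = cong suc (to-cong e p)

  index-injective : ∀ {x y} (d : Dec (R a x)) (d′ : Dec (R a y)) → index x d ≡ index y d′ → R x y
  index-injective (yes p) (yes q) _ = R-trans (R-sym p) q
  index-injective (no _) (no _) eq = to-injective e (suc-injective eq)

record FixedPointFreeInvolution {A : Set} (_∼_ : Rel A 0ℓ) : Set where
  field
    isEquivalence    : IsEquivalence _∼_
    σ                : A → A
    σ-cong           : ∀ {x y} → x ∼ y → σ x ∼ σ y
    σ-involutive     : ∀ x → σ (σ x) ∼ x
    σ-fixedPointFree : ∀ x → ¬ σ x ∼ x

  private
    module E = IsEquivalence isEquivalence

  Orbit : Rel A 0ℓ
  Orbit x y = y ∼ x ⊎ y ∼ σ x

  Orbit-isEquivalence : IsEquivalence Orbit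
  Orbit-isEquivalence = record { refl = inj₁ E.refl ; sym = orbit-sym ; trans = orbit-trans }
    where
    orbit-sym : ∀ {x y} → Orbit x y → Orbit y x
    orbit-sym (inj₁ y∼x) = inj₁ (E.sym y∼x)
    orbit-sym {x} (inj₂ y∼σx) = inj₂ (E.trans (E.sym (σ-involutive x)) (σ-cong (E.sym y∼σx)))
    orbit-trans : ∀ {x y z} → Orbit x y → Orbit y z → Orbit x z
    orbit-trans (inj₁ y∼x) (inj₁ z∼y) = inj₁ (E.trans z∼y y∼x)
    orbit-trans (inj₁ y∼x) (inj₂ z∼σy) = inj₂ (E.trans z∼σy (σ-cong y∼x))
    orbit-trans (inj₂ y∼σx) (inj₁ z∼y) = inj₂ (E.trans z∼y y∼σx)
    orbit-trans {x} (inj₂ y∼σx) (inj₂ z∼σy) = inj₁ (E.trans z∼σy (E.trans (σ-cong y∼σx) (σ-involutive x)))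

  Orbit-decidable : Decidable _∼_ → Decidable Orbit
  Orbit-decidable _∼?_ x y = (y ∼? x) ⊎-dec (y ∼? σ x)

  restrict : (P : A → Set) → (∀ {x} → P x → P (σ x)) → FixedPointFreeInvolution {Σ A P} (_∼_ on proj₁)
  restrict P σ-closed = record
    { isEquivalence    = record { refl = E.refl ; sym = E.sym ; trans = E.trans }
    ; σ                = λ u → σ (proj₁ u) , σ-closed (proj₂ u)
    ; σ-cong           = σ-cong
    ; σ-involutive     = λ u → σ-involutive (proj₁ u)
    ; σ-fixedPointFree = λ u → σ-fixedPointFree (proj₁ u)
    }

  orbit-enumeration : ∀ x → Enumeration {Σ A (Orbit x)} (_∼_ on proj₁) 2
  orbit-enumeration x = record
    { to           = λ (_ , o) → index o
    ; to-cong      = index-cong _ _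
    ; to-injective = index-injective _ _
    ; from         = λ { zero → x , inj₁ E.refl ; (suc zero) → σ x , inj₂ E.refl }
    ; to∘from      = λ { zero → refl ; (suc zero) → refl }
    }
    where
    index : ∀ {y} → Orbit x y → Fin 2
    index (inj₁ _) = zero
    index (inj₂ _) = suc zero
    σx≁x : ∀ {y z} → y ∼ x → z ∼ σ x → ¬ y ∼ z
    σx≁x y∼x z∼σx y∼z = σ-fixedPointFree x (E.trans (E.sym z∼σx) (E.trans (E.sym y∼z) y∼x))
    index-cong : ∀ {y z} (o : Orbit x y) (o′ : Orbit x z) → y ∼ z → index o ≡ index o′
    index-cong (inj₁ _) (inj₁ _) _ = refl
    index-cong (inj₁ y∼x) (inj₂ z∼σx) y∼z = ⊥-elim (σx≁x y∼x z∼σx y∼z)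
    index-cong (inj₂ y∼σx) (inj₁ z∼x) y∼z = ⊥-elim (σx≁x z∼x y∼σx (E.sym y∼z))
    index-cong (inj₂ _) (inj₂ _) _ = refl
    index-injective : ∀ {y z} (o : Orbit x y) (o′ : Orbit x z) → index o ≡ index o′ → y ∼ z
    index-injective (inj₁ y∼x) (inj₁ z∼x) _ = E.trans y∼x (E.sym z∼x)
    index-injective (inj₂ y∼σx) (inj₂ z∼σx) _ = E.trans y∼σx (E.sym z∼σx)

open FixedPointFreeInvolution using (Orbit; orbit-enumeration)

enumerateOrbits : ∀ {A : Set} {_∼_ : Rel A 0ℓ} (I : FixedPointFreeInvolution _∼_) {M} →
                  Enumeration _∼_ M → ∃[ N ] M ≡ 2 * N × Enumeration (Orbit I) N
enumerateOrbits I {zero} e = 0 , refl , record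
  { to           = to e
  ; to-cong      = λ {x} → ⊥-elim (¬Fin0 (to e x))
  ; to-injective = λ {x} → ⊥-elim (¬Fin0 (to e x))
  ; from         = λ ()
  ; to∘from      = λ ()
  }
enumerateOrbits I {suc zero} e = ⊥-elim (σ-fixedPointFree a (to-injective e (Fin1-≡ _ _)))
  where
  open FixedPointFreeInvolution I hiding (Orbit)
  a = from e zero
  Fin1-≡ : ∀ (i j : Fin 1) → i ≡ j
  Fin1-≡ zero zero = refl
enumerateOrbits {A} I {suc (suc M)} e =
  adjoinOrbitOf-a (enumerateOrbits (restrict (λ x → ¬ Orbit I a x) complement-σ-closed)
                                   (withoutBoth E.refl e a (σ a) (σ-fixedPointFree a)))
  where
  open FixedPointFreeInvolution I hiding (Orbit)
  module E = IsEquivalence isEquivalence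
  module O = IsEquivalence Orbit-isEquivalence
  a = from e zero
  complement-σ-closed : ∀ {x} → ¬ Orbit I a x → ¬ Orbit I a (σ x)
  complement-σ-closed a≁x a∼σx = a≁x (O.trans a∼σx (O.sym (inj₂ E.refl)))
  adjoinOrbitOf-a : ∃[ N ] M ≡ 2 * N × Enumeration {Σ A (λ x → ¬ Orbit I a x)} (Orbit I on proj₁) N →
                    ∃[ N ] suc (suc M) ≡ 2 * N × Enumeration (Orbit I) N
  adjoinOrbitOf-a (N , M≡2N , orbits) =
    suc N , trans (cong (2 +_) M≡2N) (sym (*-suc 2 N)) ,
    adjoinClass Orbit-isEquivalence (Orbit-decidable (decidable e)) a orbits

≈-isEquivalence : ∀ {n} → IsEquivalence (_≈_ {n} {n})
≈-isEquivalence = record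
  { refl  = λ _ → refl
  ; sym   = λ p i → sym (p i)
  ; trans = λ p q i → trans (p i) (q i)
  }

remove-zero-cong : ∀ {n} {π ρ : Perm (suc n)} → π ≈ ρ → P.remove zero π ≈ P.remove zero ρ
remove-zero-cong {π = π} {ρ} π≈ρ k = punchIn-injective (ρ ⟨$⟩ʳ zero) _ _ (begin
  punchIn (ρ ⟨$⟩ʳ zero) (P.remove zero π ⟨$⟩ʳ k) ≡⟨ cong (λ c → punchIn c _) (π≈ρ zero) ⟨
  punchIn (π ⟨$⟩ʳ zero) (P.remove zero π ⟨$⟩ʳ k) ≡⟨ P.punchIn-permute π zero k ⟨
  π ⟨$⟩ʳ suc k                                  ≡⟨ π≈ρ (suc k) ⟩
  ρ ⟨$⟩ʳ suc k                                  ≡⟨ P.punchIn-permute ρ zero k ⟩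
  punchIn (ρ ⟨$⟩ʳ zero) (P.remove zero ρ ⟨$⟩ʳ k) ∎)
  where open ≡-Reasoning

remove-zero-reflects : ∀ {n} {π ρ : Perm (suc n)} → π ⟨$⟩ʳ zero ≡ ρ ⟨$⟩ʳ zero →
                       P.remove zero π ≈ P.remove zero ρ → π ≈ ρ
remove-zero-reflects π₀≡ρ₀ _ zero = π₀≡ρ₀
remove-zero-reflects {π = π} {ρ} π₀≡ρ₀ rπ≈rρ (suc k) = begin
  π ⟨$⟩ʳ suc k                                  ≡⟨ P.punchIn-permute π zero k ⟩
  punchIn (π ⟨$⟩ʳ zero) (P.remove zero π ⟨$⟩ʳ k) ≡⟨ cong₂ punchIn π₀≡ρ₀ (rπ≈rρ k) ⟩
  punchIn (ρ ⟨$⟩ʳ zero) (P.remove zero ρ ⟨$⟩ʳ k) ≡⟨ P.punchIn-permute ρ zero k ⟨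
  ρ ⟨$⟩ʳ suc k                                  ∎
  where open ≡-Reasoning

permutations : ∀ n → Enumeration (_≈_ {n} {n}) (n !)
permutations zero = record
  { to           = λ _ → zero
  ; to-cong      = λ _ → refl
  ; to-injective = λ _ ()
  ; from         = λ _ → P.id
  ; to∘from      = λ { zero → refl }
  }
permutations (suc n) =
  reindex (λ π → π ⟨$⟩ʳ zero , P.remove zero π) (λ (j , ρ) → P.insert zero j ρ)
          (λ {π} {ρ} π≈ρ → π≈ρ zero , remove-zero-cong {π = π} {ρ} π≈ρ)
          (λ {π} {ρ} (π₀≡ρ₀ , rπ≈rρ) → remove-zero-reflects {π = π} {ρ} π₀≡ρ₀ rπ≈rρ)
          (λ (j , ρ) → refl , P.remove-insert zero j ρ)
          (×-enumeration (λ _ → permutations n))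

module Cosets {n} (s : Perm n) (s-involutive : ∀ i → s ⟨$⟩ʳ (s ⟨$⟩ʳ i) ≡ i) (s≉id : ¬ s ≈ P.id) where

  leftMultiplication : FixedPointFreeInvolution (_≈_ {n} {n})
  leftMultiplication = record
    { isEquivalence    = ≈-isEquivalence
    ; σ                = s ·_
    ; σ-cong           = λ x≈y i → cong (s ⟨$⟩ʳ_) (x≈y i)
    ; σ-involutive     = λ x i → s-involutive (x ⟨$⟩ʳ i)
    ; σ-fixedPointFree = λ x sx≈x → s≉id (λ i → begin
        s ⟨$⟩ʳ i                        ≡⟨ cong (s ⟨$⟩ʳ_) (P.inverseʳ x) ⟨
        s ⟨$⟩ʳ (x ⟨$⟩ʳ (x ⟨$⟩ˡ i))      ≡⟨ sx≈x (x ⟨$⟩ˡ i) ⟩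
        x ⟨$⟩ʳ (x ⟨$⟩ˡ i)               ≡⟨ P.inverseʳ x ⟩
        i                               ∎)
    }
    where open ≡-Reasoning

  SameCoset : Rel (Perm n) 0ℓ
  SameCoset = Orbit leftMultiplication

  private
    SameCoset-setoid : Setoid 0ℓ 0ℓ
    SameCoset-setoid = record
      { isEquivalence = FixedPointFreeInvolution.Orbit-isEquivalence leftMultiplication }
    open import Relation.Binary.Reasoning.Setoid SameCoset-setoid

  pow-involutive : ∀ k → pow s k ≈ P.id ⊎ pow s k ≈ s
  pow-involutive zero = inj₁ (λ _ → refl)
  pow-involutive (suc k) with pow-involutive k
  ... | inj₁ sᵏ≈id = inj₂ (λ i → cong (s ⟨$⟩ʳ_) (sᵏ≈id i))
  ... | inj₂ sᵏ≈s  = inj₁ (λ i → trans (cong (s ⟨$⟩ʳ_) (sᵏ≈s i)) (s-involutive i))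

  inCoset⇔sameCoset : ∀ x g → InCoset s x g ⇔ SameCoset x g
  inCoset⇔sameCoset x g = mk⇔ inCoset⇒sameCoset (λ { (inj₁ g≈x) → 0 , g≈x ; (inj₂ g≈sx) → 1 , g≈sx })
    where
    inCoset⇒sameCoset : InCoset s x g → SameCoset x g
    inCoset⇒sameCoset (k , g≈sᵏx) with pow-involutive k
    ... | inj₁ sᵏ≈id = inj₁ (λ i → trans (g≈sᵏx i) (sᵏ≈id (x ⟨$⟩ʳ i)))
    ... | inj₂ sᵏ≈s  = inj₂ (λ i → trans (g≈sᵏx i) (sᵏ≈s (x ⟨$⟩ʳ i)))

  equalCosets⇔sameCoset : ∀ x y → (∀ g → InCoset s x g ⇔ InCoset s y g) ⇔ SameCoset x y
  equalCosets⇔sameCoset x y = mk⇔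
    (λ ⟨s⟩x≡⟨s⟩y → Equivalence.to (inCoset⇔sameCoset x y)
                     (Equivalence.from (⟨s⟩x≡⟨s⟩y y) (Equivalence.from (inCoset⇔sameCoset y y) (inj₁ (λ _ → refl)))))
    (λ x~y g → mk⇔
      (λ g∈⟨s⟩x → Equivalence.from (inCoset⇔sameCoset y g) (begin
        y ≈⟨ x~y ⟨
        x ≈⟨ Equivalence.to (inCoset⇔sameCoset x g) g∈⟨s⟩x ⟩
        g ∎))
      (λ g∈⟨s⟩y → Equivalence.from (inCoset⇔sameCoset x g) (begin
        x ≈⟨ x~y ⟩
        y ≈⟨ Equivalence.to (inCoset⇔sameCoset y g) g∈⟨s⟩y ⟩
        g ∎)))

  cosets-sharing-an-element-are-equal : ∀ {x y g h} → InCoset s x g → InCoset s y h → g ≈ h →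
                                        ∀ k → InCoset s x k ⇔ InCoset s y k
  cosets-sharing-an-element-are-equal {x} {y} {g} {h} g∈⟨s⟩x h∈⟨s⟩y g≈h =
    Equivalence.from (equalCosets⇔sameCoset x y) (begin
      x ≈⟨ Equivalence.to (inCoset⇔sameCoset x g) g∈⟨s⟩x ⟩
      g ≈⟨ inj₁ (λ i → sym (g≈h i)) ⟩
      h ≈⟨ Equivalence.to (inCoset⇔sameCoset y h) h∈⟨s⟩y ⟨
      y ∎)

transpose-comm : ∀ {n} (a b k : Fin n) → PC.transpose a b k ≡ PC.transpose b a k
transpose-comm a b k with k ≟ a | k ≟ b
... | yes k≡a | yes k≡b = trans (sym k≡b) k≡a
... | yes k≡a | no k≢b rewrite dec-true (k ≟ a) k≡a = refl
... | no k≢a | yes k≡b rewrite dec-true (k ≟ b) k≡b = refl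
... | no k≢a | no k≢b rewrite dec-false (k ≟ a) k≢a | dec-false (k ≟ b) k≢b = refl

module _ {n} (a b : Fin n) where

  transpose-values : ∀ k → (k ≡ a × PC.transpose a b k ≡ b) ⊎ (k ≡ b × PC.transpose a b k ≡ a) ⊎ PC.transpose a b k ≡ k
  transpose-values k with k ≟ a
  ... | yes k≡a = inj₁ (k≡a , refl)
  ... | no _ with k ≟ b
  ...   | yes k≡b = inj₂ (inj₁ (k≡b , refl))
  ...   | no _    = inj₂ (inj₂ refl)

  transpose-sends-first : PC.transpose a b a ≡ b
  transpose-sends-first rewrite dec-true (a ≟ a) refl = refl

  transpose-involutive : ∀ k → transpose a b ⟨$⟩ʳ (transpose a b ⟨$⟩ʳ k) ≡ k
  transpose-involutive k = trans (cong (PC.transpose a b) (transpose-comm a b k)) (PC.transpose-inverse a b)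

  transpose≉id : a ≢ b → ¬ transpose a b ≈ P.id
  transpose≉id a≢b t≈id = a≢b (trans (sym (t≈id a)) transpose-sends-first)

inject₁≢suc : ∀ {m} (i : Fin m) → inject₁ i ≢ suc i
inject₁≢suc i p = m≢1+n+m (toℕ i) (trans (sym (toℕ-inject₁ i)) (cong toℕ p))

module AdjacentTranspositions (m′ : ℕ) where

  open GGraph (adjTransp (suc m′))

  module Coset (i : Fin (suc m′)) =
    Cosets (adjTransp (suc m′) i) (transpose-involutive _ _) (transpose≉id _ _ (inject₁≢suc i))

  classes-distinct : ∀ i j → adjTransp (suc m′) i ≈ adjTransp (suc m′) j → i ≡ j
  classes-distinct i j tᵢ≈tⱼ = from-values (transpose-values (inject₁ j) (suc j) (inject₁ i))
    where
    tⱼ[i] : PC.transpose (inject₁ j) (suc j) (inject₁ i) ≡ suc i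
    tⱼ[i] = trans (sym (tᵢ≈tⱼ (inject₁ i))) (transpose-sends-first (inject₁ i) (suc i))
    from-values : (inject₁ i ≡ inject₁ j × PC.transpose (inject₁ j) (suc j) (inject₁ i) ≡ suc j)
                ⊎ (inject₁ i ≡ suc j × PC.transpose (inject₁ j) (suc j) (inject₁ i) ≡ inject₁ j)
                ⊎ PC.transpose (inject₁ j) (suc j) (inject₁ i) ≡ inject₁ i → i ≡ j
    from-values (inj₁ (i≡j , _)) = inject₁-injective i≡j
    from-values (inj₂ (inj₁ (i≡1+j , tⱼ[i]≡j))) = ⊥-elim (m≢1+n+m (toℕ j) (begin
      toℕ j               ≡⟨ toℕ-inject₁ j ⟨
      toℕ (inject₁ j)     ≡⟨ cong toℕ (trans (sym tⱼ[i]≡j) tⱼ[i]) ⟩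
      suc (toℕ i)         ≡⟨ cong suc (trans (sym (toℕ-inject₁ i)) (cong toℕ i≡1+j)) ⟩
      suc (suc (toℕ j))   ∎))
      where open ≡-Reasoning
    from-values (inj₂ (inj₂ tⱼ[i]≡i)) = ⊥-elim (inject₁≢suc i (trans (sym tⱼ[i]≡i) tⱼ[i]))

  partite : PartiteByClasses
  partite = classes-distinct , λ _ _ same-class _ (different-classes , _) → different-classes same-class

  cosets : ∀ i → Enumeration (Coset.SameCoset i) (suc (suc m′) ! / 2)
  cosets i with enumerateOrbits (Coset.leftMultiplication i) (permutations (suc (suc m′)))
  ... | N , n!≡2N , orbits = subst (Enumeration _) N≡n!/2 orbits
    where
    N≡n!/2 : N ≡ suc (suc m′) ! / 2
    N≡n!/2 = sym (trans (cong (_/ 2) (trans n!≡2N (*-comm 2 N))) (m*n/n≡m N 2))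

  vertex-count : suc m′ * (suc (suc m′) ! / 2) ≡ (suc (suc m′) * suc m′ * suc m′ !) / 2
  vertex-count = begin
    m * (n ! / 2)   ≡⟨ *-/-assoc m (m≤n⇒m!∣n! {2} {n} (s≤s (s≤s z≤n))) ⟨
    m * n ! / 2     ≡⟨ cong (_/ 2) (trans (sym (*-assoc m n (m !))) (cong (_* m !) (*-comm m n))) ⟩
    n * m * m ! / 2 ∎
    where
    open ≡-Reasoning
    m = suc m′
    n = suc m

  vertices : HasVertices ((suc (suc m′) * suc m′ * suc m′ !) / 2)
  vertices = subst HasVertices vertex-count (Enumeration⇒HasCard VertexSetoid
    (reindex (λ v → v) (λ v → v)
             (λ { {i , x} {_ , y} (refl , ⟨tᵢ⟩x≡⟨tᵢ⟩y) → refl , Equivalence.to (Coset.equalCosets⇔sameCoset i x y) ⟨tᵢ⟩x≡⟨tᵢ⟩y })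
             (λ { {i , x} {_ , y} (refl , x~y) → refl , Equivalence.from (Coset.equalCosets⇔sameCoset i x y) x~y })
             (λ (i , _) → refl , inj₁ (λ _ → refl))
             (×-enumeration cosets)))

  edges : ∀ i x → Enumeration (Setoid._≈_ (IncidentSetoid (i , x))) (m′ * 2)
  edges i x = reindex edge⇒coordinates coordinates⇒edge
                      (λ { {_ , i≢j , _} {_ , i≢j′ , _} ((j≡j′ , _) , g≈g′) →
                             punchOut-cong i {i≢j = i≢j} {i≢j′} j≡j′ , g≈g′ })
                      (λ {e} {e′} → reflects {e} {e′})
                      (λ _ → punchOut-punchIn i , λ _ → refl)
                      (×-enumeration (λ _ → orbit-enumeration (Coset.leftMultiplication i) x))
    where
    Edge = Setoid.Carrier (IncidentSetoid (i , x))
    Coordinates = Fin m′ × Σ (Perm (suc (suc m′))) (Coset.SameCoset i x)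

    edge⇒coordinates : Edge → Coordinates
    edge⇒coordinates (((_ , _) , g) , i≢j , g∈⟨tᵢ⟩x , _) =
      punchOut i≢j , g , Equivalence.to (Coset.inCoset⇔sameCoset i x g) g∈⟨tᵢ⟩x

    coordinates⇒edge : Coordinates → Edge
    coordinates⇒edge (c , g , x~g) =
      ((punchIn i c , g) , g) , (λ p → punchInᵢ≢i i c (sym p)) ,
      Equivalence.from (Coset.inCoset⇔sameCoset i x g) x~g , (0 , λ _ → refl)

    reflects : ∀ {e e′} → Fibrewise (λ _ → _≈_ on proj₁) (edge⇒coordinates e) (edge⇒coordinates e′) →
               Setoid._≈_ (IncidentSetoid (i , x)) e e′
    reflects {((j , y) , g) , i≢j , _ , g∈⟨tⱼ⟩y} {((_ , y′) , g′) , i≢j′ , _ , g′∈⟨tⱼ′⟩y′} (c≡c′ , g≈g′)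
      with punchOut-injective i≢j i≢j′ c≡c′
    ... | refl = (refl , Coset.cosets-sharing-an-element-are-equal j {y} {y′} {g} {g′} g∈⟨tⱼ⟩y g′∈⟨tⱼ′⟩y′ g≈g′) , g≈g′

  regular : Regular (2 * suc (suc m′) ∸ 4)
  regular (i , x) = Enumeration⇒HasCard (IncidentSetoid (i , x)) (subst (Enumeration _) degree (edges i x))
    where
    degree : m′ * 2 ≡ 2 * suc (suc m′) ∸ 4
    degree = trans (*-comm m′ 2) (cong (_∸ 4) (sym (trans (*-suc 2 (suc m′)) (cong (2 +_) (*-suc 2 m′)))))

theorem4p3p3 : (m : ℕ) → 2 ≤ m →
    let n = suc m
        open GGraph (adjTransp m)
    in PartiteByClasses
       × Regular (2 * n ∸ 4)
       × HasVertices ((n * (n ∸ 1) * (n ∸ 1) !) / 2)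
theorem4p3p3 zero ()
theorem4p3p3 (suc m′) _ = partite , regular , vertices
  where open AdjacentTranspositions m′
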